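{- For every prime $p>2$ and every positive integer $n$, the $\mathrm{VC}$-dimension of $\mathrm{GS}(p,n)\subseteq\mathbb{F}_p^n$ is at most $3$.
   Context: Let $w_1,\dots,w_n$ be the standard basis of $\mathbb{F}_p^n$. The linear Green–Sanders example is $\mathrm{GS}(p,n)=\{x\in\mathbb{F}_p^n : \exists i \text{ such that } w_j^T x = 0 \text{ for all } j<i \text{ and } w_i^T x = 1\}$. For a finite abelian group $G$ and $A\subseteq G$, $A$ has $\mathrm{VC}$-dimension at least $k$ ($k\ge1$) if there exist elements $\{x_i : i\in[k]\}\cup\{y_S : S\subseteq[k]\}$ of $G$ such that $x_i+y_S\in A$ if and only if $i\in S$; the $\mathrm{VC}$-dimension of $A$ is the largest such $k$. -}

module Defs where

open import Level using (Level; suc; _⊔_)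
open import Data.Nat using (ℕ; NonZero; _<_)
open import Data.Nat.DivMod using (_mod_)
open import Data.Fin using (Fin; toℕ)
open import Data.Fin.Subset using (Subset; _∈_)
open import Data.Product using (Σ; _×_)
open import Function.Bundles using (_⇔_)
open import Relation.Binary.PropositionalEquality using (_≡_)

𝔽 : ℕ → Set
𝔽 p = Fin p

_+𝔽_ : {p : ℕ} .{{_ : NonZero p}} → 𝔽 p → 𝔽 p → 𝔽 p
_+𝔽_ {p} a b = (toℕ a Data.Nat.+ toℕ b) mod p

0𝔽 : (p : ℕ) .{{_ : NonZero p}} → 𝔽 p
0𝔽 p = 0 mod p

1𝔽 : (p : ℕ) .{{_ : NonZero p}} → 𝔽 p
1𝔽 p = 1 mod p

Vecp : ℕ → ℕ → Set
Vecp p n = Fin n → 𝔽 p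

_⊕_ : {p n : ℕ} .{{_ : NonZero p}} → Vecp p n → Vecp p n → Vecp p n
(x ⊕ y) j = x j +𝔽 y j

-- w_j^T x is the j-th coordinate x j.
-- GS(p,n) = { x : ∃ i, x_j = 0 for all j < i, and x_i = 1 }
GS : (p n : ℕ) .{{_ : NonZero p}} → Vecp p n → Set
GS p n x = Σ (Fin n) λ i → ((j : Fin n) → toℕ j < toℕ i → x j ≡ 0𝔽 p) × (x i ≡ 1𝔽 p)

HasVCDimAtLeast : {a ℓ : Level} {G : Set a} → (G → G → G) → (G → Set ℓ) → ℕ → Set (a ⊔ ℓ)
HasVCDimAtLeast {G = G} _+_ A k =
  Σ (Fin k → G) λ x → Σ (Subset k → G) λ y →
    (i : Fin k) (S : Subset k) → A (x i + y S) ⇔ (i ∈ S)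

-- A vector lies in GS exactly when its first nonzero coordinate is 1. Suppose
-- x₀,…,x₃ and the y_S witness VC-dimension 4. If x_a and x_c first differ at
-- coordinate d, then x_a and xb cannot also agree at d: x_a + y_{a} and
-- x_a + y_{a,c} lie in GS while xb + y_{a} and xb + y_{a,c} do not, which forces
-- both to vanish up to d; so y_{a} and y_{a,c} agree up to d, and membership of
-- x_c + y_{a,c} in GS (its coordinate d is nonzero) transfers to x_c + y_{a}.
-- Hence x₁, x₂, x₃ all split off from x₀ at one coordinate d, with pairwise
-- distinct values there. Both x₀ + y_{0,j} and x_j + y_{0,j} lie in GS and vanish
-- before d, so their coordinates d are 0 and 1 in some order, i.e.
-- x_j(d) = x₀(d) ± 1: three distinct values cannot fit in these two slots.
module Submission where

open import Defs
open import Algebra.Bundles using (AbelianGroup)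
open import Algebra.Structures using (IsAbelianGroup)
open import Algebra.Definitions using (Commutative; Associative; RightIdentity; RightInverse)
open import Algebra.Consequences.Propositional using (comm∧idʳ⇒id; comm∧invʳ⇒inv)
import Algebra.Properties.AbelianGroup as AbelianGroupProperties
import Algebra.Properties.CommutativeSemigroup as CommutativeSemigroupProperties
open import Level using (0ℓ)
open import Data.Nat using (ℕ; NonZero; suc; _+_; _∸_; _%_; _<_; _≤_; _≤?_; _<?_; s≤s; s≤s⁻¹; >-nonZero⁻¹)
open import Data.Nat.Properties
  using (+-comm; +-assoc; +-identityʳ; ≤-refl; <-≤-trans; ≤-trans; <⇒≤; ≮⇒≥; ≰⇒>; m<n⇒m<1+n; m≤n⇒m<n∨m≡n; m+[n∸m]≡n)
open import Data.Nat.DivMod using (_mod_; %-distribˡ-+; m%n%n≡m%n; m<n⇒m%n≡m; n%n≡0)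
open import Data.Nat.Primality using (Prime)
open import Data.Fin using (Fin; toℕ; fromℕ<; zero; suc)
open import Data.Fin.Properties using (toℕ-injective; toℕ-fromℕ<; toℕ-inject; toℕ<n; _≟_; <-cmp; ¬∀⟶∃¬-smallest)
open import Data.Fin.Subset using (Subset; _∈_; _∉_; ⁅_⁆; _∪_)
open import Data.Fin.Subset.Properties using (x∈⁅x⁆; x∈⁅y⁆⇒x≡y; x∈p∪q⁺; x∈p∪q⁻)
open import Data.Product using (∃; _×_; _,_; proj₁; proj₂)
open import Data.Sum using (_⊎_; inj₁; inj₂; [_,_])
open import Data.Empty using (⊥; ⊥-elim)
open import Function.Base using (_∘_)
open import Function.Bundles using (_⇔_; Equivalence)
open import Relation.Binary.Definitions using (tri<; tri≈; tri>)
open import Relation.Binary.PropositionalEquality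
  using (_≡_; _≢_; sym; trans; cong; cong₂; subst; isEquivalence; module ≡-Reasoning)
open import Relation.Nullary using (¬_; yes; no)

module _ {p : ℕ} .{{_ : NonZero p}} where

  toℕ-mod : ∀ m → toℕ (m mod p) ≡ m % p
  toℕ-mod m = toℕ-fromℕ< _

  toℕ-+𝔽 : (a b : 𝔽 p) → toℕ (a +𝔽 b) ≡ (toℕ a + toℕ b) % p
  toℕ-+𝔽 a b = toℕ-mod (toℕ a + toℕ b)

  toℕ-0𝔽 : toℕ (0𝔽 p) ≡ 0
  toℕ-0𝔽 = trans (toℕ-mod 0) (m<n⇒m%n≡m (>-nonZero⁻¹ p))

  toℕ-%p : (a : 𝔽 p) → toℕ a % p ≡ toℕ a
  toℕ-%p a = m<n⇒m%n≡m (toℕ<n a)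

  [m%p+n]%p≡[m+n]%p : ∀ m n → (m % p + n) % p ≡ (m + n) % p
  [m%p+n]%p≡[m+n]%p m n = begin
    (m % p + n) % p          ≡⟨ %-distribˡ-+ (m % p) n p ⟩
    (m % p % p + n % p) % p  ≡⟨ cong (λ r → (r + n % p) % p) (m%n%n≡m%n m p) ⟩
    (m % p + n % p) % p      ≡⟨ %-distribˡ-+ m n p ⟨
    (m + n) % p              ∎
    where open ≡-Reasoning

  [m+n%p]%p≡[m+n]%p : ∀ m n → (m + n % p) % p ≡ (m + n) % p
  [m+n%p]%p≡[m+n]%p m n = begin
    (m + n % p) % p  ≡⟨ cong (_% p) (+-comm m (n % p)) ⟩
    (n % p + m) % p  ≡⟨ [m%p+n]%p≡[m+n]%p n m ⟩
    (n + m) % p      ≡⟨ cong (_% p) (+-comm n m) ⟩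
    (m + n) % p      ∎
    where open ≡-Reasoning

  +𝔽-comm : Commutative _≡_ (_+𝔽_ {p})
  +𝔽-comm a b = toℕ-injective (begin
    toℕ (a +𝔽 b)           ≡⟨ toℕ-+𝔽 a b ⟩
    (toℕ a + toℕ b) % p    ≡⟨ cong (_% p) (+-comm (toℕ a) (toℕ b)) ⟩
    (toℕ b + toℕ a) % p    ≡⟨ toℕ-+𝔽 b a ⟨
    toℕ (b +𝔽 a)           ∎)
    where open ≡-Reasoning

  +𝔽-assoc : Associative _≡_ (_+𝔽_ {p})
  +𝔽-assoc a b c = toℕ-injective (begin
    toℕ ((a +𝔽 b) +𝔽 c)                ≡⟨ toℕ-+𝔽 (a +𝔽 b) c ⟩
    (toℕ (a +𝔽 b) + toℕ c) % p         ≡⟨ cong (λ r → (r + toℕ c) % p) (toℕ-+𝔽 a b) ⟩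
    ((toℕ a + toℕ b) % p + toℕ c) % p  ≡⟨ [m%p+n]%p≡[m+n]%p (toℕ a + toℕ b) (toℕ c) ⟩
    (toℕ a + toℕ b + toℕ c) % p        ≡⟨ cong (_% p) (+-assoc (toℕ a) (toℕ b) (toℕ c)) ⟩
    (toℕ a + (toℕ b + toℕ c)) % p      ≡⟨ [m+n%p]%p≡[m+n]%p (toℕ a) (toℕ b + toℕ c) ⟨
    (toℕ a + (toℕ b + toℕ c) % p) % p  ≡⟨ cong (λ r → (toℕ a + r) % p) (toℕ-+𝔽 b c) ⟨
    (toℕ a + toℕ (b +𝔽 c)) % p         ≡⟨ toℕ-+𝔽 a (b +𝔽 c) ⟨
    toℕ (a +𝔽 (b +𝔽 c))                ∎)
    where open ≡-Reasoning

  +𝔽-identityʳ : RightIdentity _≡_ (0𝔽 p) _+𝔽_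
  +𝔽-identityʳ a = toℕ-injective (begin
    toℕ (a +𝔽 0𝔽 p)               ≡⟨ toℕ-+𝔽 a (0𝔽 p) ⟩
    (toℕ a + toℕ (0𝔽 p)) % p      ≡⟨ cong (λ r → (toℕ a + r) % p) toℕ-0𝔽 ⟩
    (toℕ a + 0) % p               ≡⟨ cong (_% p) (+-identityʳ (toℕ a)) ⟩
    toℕ a % p                     ≡⟨ toℕ-%p a ⟩
    toℕ a                         ∎)
    where open ≡-Reasoning

  -𝔽_ : 𝔽 p → 𝔽 p
  -𝔽 a = (p ∸ toℕ a) mod p

  +𝔽-inverseʳ : RightInverse _≡_ (0𝔽 p) -𝔽_ _+𝔽_
  +𝔽-inverseʳ a = toℕ-injective (begin
    toℕ (a +𝔽 (-𝔽 a))               ≡⟨ toℕ-+𝔽 a (-𝔽 a) ⟩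
    (toℕ a + toℕ (-𝔽 a)) % p       ≡⟨ cong (λ r → (toℕ a + r) % p) (toℕ-mod (p ∸ toℕ a)) ⟩
    (toℕ a + (p ∸ toℕ a) % p) % p  ≡⟨ [m+n%p]%p≡[m+n]%p (toℕ a) (p ∸ toℕ a) ⟩
    (toℕ a + (p ∸ toℕ a)) % p      ≡⟨ cong (_% p) (m+[n∸m]≡n (<⇒≤ (toℕ<n a))) ⟩
    p % p                          ≡⟨ n%n≡0 p ⟩
    0                              ≡⟨ toℕ-0𝔽 ⟨
    toℕ (0𝔽 p)                     ∎)
    where open ≡-Reasoning

  +𝔽-isAbelianGroup : IsAbelianGroup _≡_ _+𝔽_ (0𝔽 p) -𝔽_
  +𝔽-isAbelianGroup = record
    { isGroup = record
      { isMonoid = record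
        { isSemigroup = record
          { isMagma = record { isEquivalence = isEquivalence ; ∙-cong = cong₂ _+𝔽_ }
          ; assoc = +𝔽-assoc
          }
        ; identity = comm∧idʳ⇒id +𝔽-comm +𝔽-identityʳ
        }
      ; inverse = comm∧invʳ⇒inv +𝔽-comm +𝔽-inverseʳ
      ; ⁻¹-cong = cong -𝔽_
      }
    ; comm = +𝔽-comm
    }

  +𝔽-abelianGroup : AbelianGroup 0ℓ 0ℓ
  +𝔽-abelianGroup = record { isAbelianGroup = +𝔽-isAbelianGroup }

  open AbelianGroupProperties +𝔽-abelianGroup public
    using () renaming (∙-cancelʳ to +𝔽-cancelʳ; ∙-cancelˡ to +𝔽-cancelˡ)
  open CommutativeSemigroupProperties (AbelianGroup.commutativeSemigroup +𝔽-abelianGroup)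
    using (xy∙z≈xz∙y)

  0𝔽≢1𝔽 : 1 < p → 0𝔽 p ≢ 1𝔽 p
  0𝔽≢1𝔽 1<p 0≡1 with trans (sym toℕ-0𝔽) (trans (cong toℕ 0≡1) (trans (toℕ-mod 1) (m<n⇒m%n≡m 1<p)))
  ... | ()

  Adjacent : 𝔽 p → 𝔽 p → Set
  Adjacent a b = b ≡ a +𝔽 1𝔽 p ⊎ a ≡ b +𝔽 1𝔽 p

  +𝔽-0-1⇒adjacent : ∀ {a b t} → a +𝔽 t ≡ 0𝔽 p → b +𝔽 t ≡ 1𝔽 p → b ≡ a +𝔽 1𝔽 p
  +𝔽-0-1⇒adjacent {a} {b} {t} a+t≡0 b+t≡1 = +𝔽-cancelʳ t b (a +𝔽 1𝔽 p) (begin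
    b +𝔽 t               ≡⟨ b+t≡1 ⟩
    1𝔽 p                 ≡⟨ +𝔽-identityʳ (1𝔽 p) ⟨
    1𝔽 p +𝔽 0𝔽 p         ≡⟨ +𝔽-comm (1𝔽 p) (0𝔽 p) ⟩
    0𝔽 p +𝔽 1𝔽 p         ≡⟨ cong (_+𝔽 1𝔽 p) a+t≡0 ⟨
    (a +𝔽 t) +𝔽 1𝔽 p     ≡⟨ xy∙z≈xz∙y a t (1𝔽 p) ⟩
    (a +𝔽 1𝔽 p) +𝔽 t     ∎)
    where open ≡-Reasoning

  +𝔽-0∨1⇒adjacent : ∀ {a b t} → a ≢ b →
    a +𝔽 t ≡ 0𝔽 p ⊎ a +𝔽 t ≡ 1𝔽 p → b +𝔽 t ≡ 0𝔽 p ⊎ b +𝔽 t ≡ 1𝔽 p → Adjacent a b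
  +𝔽-0∨1⇒adjacent a≢b (inj₁ a0) (inj₁ b0) = ⊥-elim (a≢b (+𝔽-cancelʳ _ _ _ (trans a0 (sym b0))))
  +𝔽-0∨1⇒adjacent a≢b (inj₂ a1) (inj₂ b1) = ⊥-elim (a≢b (+𝔽-cancelʳ _ _ _ (trans a1 (sym b1))))
  +𝔽-0∨1⇒adjacent a≢b (inj₁ a0) (inj₂ b1) = inj₁ (+𝔽-0-1⇒adjacent a0 b1)
  +𝔽-0∨1⇒adjacent a≢b (inj₂ a1) (inj₁ b0) = inj₂ (+𝔽-0-1⇒adjacent b0 a1)

  ¬three-adjacent : ∀ {a b₁ b₂ b₃} → b₁ ≢ b₂ → b₁ ≢ b₃ → b₂ ≢ b₃ →
    Adjacent a b₁ → Adjacent a b₂ → Adjacent a b₃ → ⊥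
  ¬three-adjacent b₁≢b₂ _ _ (inj₁ e₁) (inj₁ e₂) _ = b₁≢b₂ (trans e₁ (sym e₂))
  ¬three-adjacent _ b₁≢b₃ _ (inj₁ e₁) (inj₂ _) (inj₁ e₃) = b₁≢b₃ (trans e₁ (sym e₃))
  ¬three-adjacent _ _ b₂≢b₃ (inj₁ _) (inj₂ e₂) (inj₂ e₃) = b₂≢b₃ (+𝔽-cancelʳ _ _ _ (trans (sym e₂) e₃))
  ¬three-adjacent _ _ b₂≢b₃ (inj₂ _) (inj₁ e₂) (inj₁ e₃) = b₂≢b₃ (trans e₂ (sym e₃))
  ¬three-adjacent _ b₁≢b₃ _ (inj₂ e₁) (inj₁ _) (inj₂ e₃) = b₁≢b₃ (+𝔽-cancelʳ _ _ _ (trans (sym e₁) e₃))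
  ¬three-adjacent b₁≢b₂ _ _ (inj₂ e₁) (inj₂ e₂) _ = b₁≢b₂ (+𝔽-cancelʳ _ _ _ (trans (sym e₁) e₂))

module _ {p n : ℕ} .{{_ : NonZero p}} where

  AgreeBelow : ℕ → Vecp p n → Vecp p n → Set
  AgreeBelow e u v = ∀ m → toℕ m < e → u m ≡ v m

  ZeroBelow : ℕ → Vecp p n → Set
  ZeroBelow e u = AgreeBelow e u (λ _ → 0𝔽 p)

  FirstDiff : Vecp p n → Vecp p n → Fin n → Set
  FirstDiff u v d = AgreeBelow (toℕ d) u v × u d ≢ v d

  agreeBelow-suc : ∀ {u v d} → AgreeBelow (toℕ d) u v → u d ≡ v d → AgreeBelow (suc (toℕ d)) u v
  agreeBelow-suc {u} {v} u≈v ud≡vd m m≤d with m≤n⇒m<n∨m≡n (s≤s⁻¹ m≤d)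
  ... | inj₁ m<d = u≈v m m<d
  ... | inj₂ m≡d = subst (λ j → u j ≡ v j) (sym (toℕ-injective m≡d)) ud≡vd

  firstDiff : ∀ {u v} → ¬ (∀ m → u m ≡ v m) → ∃ (FirstDiff u v)
  firstDiff {u} {v} u≉v with ¬∀⟶∃¬-smallest n (λ m → u m ≡ v m) (λ m → u m ≟ v m) u≉v
  ... | d , ud≢vd , agree = d , below , ud≢vd
    where
    below : AgreeBelow (toℕ d) u v
    below m m<d = subst (λ j → u j ≡ v j) m′≡m (agree (fromℕ< m<d))
      where m′≡m = toℕ-injective (trans (toℕ-inject (fromℕ< m<d)) (toℕ-fromℕ< m<d))

  GS-resp-prefix : ∀ {u v} (u∈ : GS p n u) → AgreeBelow (suc (toℕ (proj₁ u∈))) u v → GS p n v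
  GS-resp-prefix (i , zeros , uᵢ≡1) u≈v =
    i , (λ j j<i → trans (sym (u≈v j (m<n⇒m<1+n j<i))) (zeros j j<i)) , trans (sym (u≈v i (s≤s ≤-refl))) uᵢ≡1

  GS-resp-nonzeroPrefix : ∀ {u v d} → AgreeBelow (suc (toℕ d)) u v → u d ≢ 0𝔽 p → GS p n u → GS p n v
  GS-resp-nonzeroPrefix {d = d} u≈v ud≢0 u∈@(i , zeros , _) with toℕ i ≤? toℕ d
  ... | yes i≤d = GS-resp-prefix u∈ (λ j j≤i → u≈v j (≤-trans j≤i (s≤s i≤d)))
  ... | no i≰d = ⊥-elim (ud≢0 (zeros d (≰⇒> i≰d)))

  GS-separated⇒zeroBelow : ∀ {u v e} → AgreeBelow e u v → GS p n u → ¬ GS p n v → ZeroBelow e u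
  GS-separated⇒zeroBelow {e = e} u≈v u∈@(i , zeros , _) v∉ m m<e with toℕ i <? e
  ... | yes i<e = ⊥-elim (v∉ (GS-resp-prefix u∈ (λ j j≤i → u≈v j (<-≤-trans j≤i i<e))))
  ... | no i≮e = zeros m (<-≤-trans m<e (≮⇒≥ i≮e))

  GS-zeroBelow⇒0∨1 : 1 < p → ∀ {u d} → ZeroBelow (toℕ d) u → GS p n u → u d ≡ 0𝔽 p ⊎ u d ≡ 1𝔽 p
  GS-zeroBelow⇒0∨1 1<p {u} {d} zeroBelow (i , zeros , uᵢ≡1) with <-cmp i d
  ... | tri< i<d _ _ = ⊥-elim (0𝔽≢1𝔽 1<p (trans (sym (zeroBelow i i<d)) uᵢ≡1))
  ... | tri≈ _ i≡d _ = inj₂ (subst (λ j → u j ≡ 1𝔽 p) i≡d uᵢ≡1)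
  ... | tri> _ _ d<i = inj₁ (zeros d d<i)

module _ {k : ℕ} where

  ≢⇒∉⁅⁆ : ∀ {a j : Fin k} → j ≢ a → j ∉ ⁅ a ⁆
  ≢⇒∉⁅⁆ {a} j≢a j∈⁅a⁆ = j≢a (x∈⁅y⁆⇒x≡y a j∈⁅a⁆)

  ≢⇒∉⁅⁆∪⁅⁆ : ∀ {a b j : Fin k} → j ≢ a → j ≢ b → j ∉ ⁅ a ⁆ ∪ ⁅ b ⁆
  ≢⇒∉⁅⁆∪⁅⁆ {a} {b} j≢a j≢b j∈ = [ ≢⇒∉⁅⁆ j≢a , ≢⇒∉⁅⁆ j≢b ] (x∈p∪q⁻ ⁅ a ⁆ ⁅ b ⁆ j∈)

module Shattering {p n k : ℕ} .{{_ : NonZero p}} (1<p : 1 < p)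
  (x : Fin k → Vecp p n) (y : Subset k → Vecp p n)
  (shatters : ∀ i S → GS p n (x i ⊕ y S) ⇔ i ∈ S) where

  ∈⇒GS : ∀ {i S} → i ∈ S → GS p n (x i ⊕ y S)
  ∈⇒GS = Equivalence.from (shatters _ _)

  ∉⇒¬GS : ∀ {i S} → i ∉ S → ¬ GS p n (x i ⊕ y S)
  ∉⇒¬GS i∉S i∈GS = i∉S (Equivalence.to (shatters _ _) i∈GS)

  ⊕y-agreeBelow : ∀ {e i j} S → AgreeBelow e (x i) (x j) → AgreeBelow e (x i ⊕ y S) (x j ⊕ y S)
  ⊕y-agreeBelow S xᵢ≈xⱼ m m<e = cong (_+𝔽 y S m) (xᵢ≈xⱼ m m<e)

  x-injective : ∀ {i j} → i ≢ j → ¬ (∀ m → x i m ≡ x j m)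
  x-injective {i} {j} i≢j xᵢ≗xⱼ = ∉⇒¬GS (≢⇒∉⁅⁆ (i≢j ∘ sym)) (GS-resp-prefix (∈⇒GS (x∈⁅x⁆ i)) xᵢ⊕y≈xⱼ⊕y)
    where
    xᵢ⊕y≈xⱼ⊕y : ∀ {e} → AgreeBelow e (x i ⊕ y ⁅ i ⁆) (x j ⊕ y ⁅ i ⁆)
    xᵢ⊕y≈xⱼ⊕y m _ = cong (_+𝔽 y ⁅ i ⁆ m) (xᵢ≗xⱼ m)

  ¬agreePastFirstDiff : ∀ {a b c d} → a ≢ b → a ≢ c → b ≢ c →
    FirstDiff (x a) (x c) d → ¬ AgreeBelow (suc (toℕ d)) (x a) (x b)
  ¬agreePastFirstDiff {a} {b} {c} {d} a≢b a≢c b≢c (xa≈xc , xad≢xcd) xa≈xb =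
    ∉⇒¬GS (≢⇒∉⁅⁆ (a≢c ∘ sym)) (GS-resp-nonzeroPrefix xc⊕ySac≈xc⊕ySa nonzero (∈⇒GS (x∈p∪q⁺ (inj₂ (x∈⁅x⁆ c)))))
    where
    Sa = ⁅ a ⁆
    Sac = ⁅ a ⁆ ∪ ⁅ c ⁆
    zeroUpTo : ∀ {S} → a ∈ S → b ∉ S → ZeroBelow (suc (toℕ d)) (x a ⊕ y S)
    zeroUpTo {S} a∈S b∉S = GS-separated⇒zeroBelow (⊕y-agreeBelow S xa≈xb) (∈⇒GS a∈S) (∉⇒¬GS b∉S)
    za : ZeroBelow (suc (toℕ d)) (x a ⊕ y Sa)
    za = zeroUpTo (x∈⁅x⁆ a) (≢⇒∉⁅⁆ (a≢b ∘ sym))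
    zac : ZeroBelow (suc (toℕ d)) (x a ⊕ y Sac)
    zac = zeroUpTo (x∈p∪q⁺ (inj₁ (x∈⁅x⁆ a))) (≢⇒∉⁅⁆∪⁅⁆ (a≢b ∘ sym) b≢c)
    xc⊕ySac≈xc⊕ySa : AgreeBelow (suc (toℕ d)) (x c ⊕ y Sac) (x c ⊕ y Sa)
    xc⊕ySac≈xc⊕ySa m m≤d = cong (x c m +𝔽_) (+𝔽-cancelˡ (x a m) _ _ (trans (zac m m≤d) (sym (za m m≤d))))
    nonzero : (x c ⊕ y Sac) d ≢ 0𝔽 p
    nonzero xc+y≡0 = xad≢xcd (+𝔽-cancelʳ (y Sac d) _ _ (trans (zac d (s≤s ≤-refl)) (sym xc+y≡0)))

  firstDiff-common : ∀ {a b c d} → a ≢ b → a ≢ c → b ≢ c →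
    FirstDiff (x a) (x b) d → FirstDiff (x a) (x c) d
  firstDiff-common {a} {b} {c} {d} a≢b a≢c b≢c F with firstDiff (x-injective a≢c)
  ... | d′ , F′ with <-cmp d d′
  ...   | tri< d<d′ _ _ = ⊥-elim (¬agreePastFirstDiff a≢c a≢b (b≢c ∘ sym) F
                            (λ m m≤d → proj₁ F′ m (<-≤-trans m≤d d<d′)))
  ...   | tri≈ _ d≡d′ _ = subst (FirstDiff (x a) (x c)) (sym d≡d′) F′
  ...   | tri> _ _ d′<d = ⊥-elim (¬agreePastFirstDiff a≢b a≢c b≢c F′
                            (λ m m≤d′ → proj₁ F m (<-≤-trans m≤d′ d′<d)))

  firstDiff-values-distinct : ∀ {a b c d} → a ≢ b → a ≢ c → b ≢ c →
    FirstDiff (x a) (x b) d → FirstDiff (x a) (x c) d → x b d ≢ x c d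
  firstDiff-values-distinct a≢b a≢c b≢c (xa≈xb , xad≢xbd) (xa≈xc , _) xbd≡xcd =
    ¬agreePastFirstDiff b≢c (a≢b ∘ sym) (a≢c ∘ sym)
      ((λ m m<d → sym (xa≈xb m m<d)) , xad≢xbd ∘ sym)
      (agreeBelow-suc (λ m m<d → trans (sym (xa≈xb m m<d)) (xa≈xc m m<d)) xbd≡xcd)

  firstDiff-value-adjacent : ∀ {a b c d} → a ≢ c → b ≢ c →
    FirstDiff (x a) (x b) d → AgreeBelow (toℕ d) (x a) (x c) → Adjacent (x a d) (x b d)
  firstDiff-value-adjacent {a} {b} {c} {d} a≢c b≢c (xa≈xb , xad≢xbd) xa≈xc =
    +𝔽-0∨1⇒adjacent xad≢xbd
      (GS-zeroBelow⇒0∨1 1<p za (∈⇒GS (x∈p∪q⁺ (inj₁ (x∈⁅x⁆ a)))))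
      (GS-zeroBelow⇒0∨1 1<p zb (∈⇒GS (x∈p∪q⁺ (inj₂ (x∈⁅x⁆ b)))))
    where
    S = ⁅ a ⁆ ∪ ⁅ b ⁆
    za : ZeroBelow (toℕ d) (x a ⊕ y S)
    za = GS-separated⇒zeroBelow (⊕y-agreeBelow S xa≈xc) (∈⇒GS (x∈p∪q⁺ (inj₁ (x∈⁅x⁆ a))))
           (∉⇒¬GS (≢⇒∉⁅⁆∪⁅⁆ (a≢c ∘ sym) (b≢c ∘ sym)))
    zb : ZeroBelow (toℕ d) (x b ⊕ y S)
    zb m m<d = trans (cong (_+𝔽 y S m) (sym (xa≈xb m m<d))) (za m m<d)

  ¬four-distinct : ∀ {a b c e} → a ≢ b → a ≢ c → a ≢ e → b ≢ c → b ≢ e → c ≢ e → ⊥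
  ¬four-distinct a≢b a≢c a≢e b≢c b≢e c≢e =
    ¬three-adjacent
      (firstDiff-values-distinct a≢b a≢c b≢c Fb Fc)
      (firstDiff-values-distinct a≢b a≢e b≢e Fb Fe)
      (firstDiff-values-distinct a≢c a≢e c≢e Fc Fe)
      (firstDiff-value-adjacent a≢c b≢c Fb (proj₁ Fc))
      (firstDiff-value-adjacent a≢b (b≢c ∘ sym) Fc (proj₁ Fb))
      (firstDiff-value-adjacent a≢b (b≢e ∘ sym) Fe (proj₁ Fb))
    where
    Fb = proj₂ (firstDiff (x-injective a≢b))
    Fc = firstDiff-common a≢b a≢c b≢c Fb
    Fe = firstDiff-common a≢b a≢e b≢e Fb

theorem2p2 : (p : ℕ) .{{_ : NonZero p}} → Prime p → 2 < p → (n : ℕ) → 1 ≤ n →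
    (k : ℕ) → 4 ≤ k → ¬ HasVCDimAtLeast (_⊕_ {p} {n}) (GS p n) k
theorem2p2 p _ 2<p n _ k (s≤s (s≤s (s≤s (s≤s _)))) (x , y , shatters) =
  ¬four-distinct {a = zero} {b = suc zero} {c = suc (suc zero)} {e = suc (suc (suc zero))}
    (λ ()) (λ ()) (λ ()) (λ ()) (λ ()) (λ ())
  where open Shattering (<⇒≤ 2<p) x y shatters
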